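{- Let $A$ be a c.e. set. Suppose $\{R_0,R_1,\dots\}$ and $\{D_0,D_1,\dots\}$ are each collections of pairwise disjoint c.e. sets generating $\mathcal{D}(A)$, and every $R_i$ is computable. Then every $D_i$ is computable.
   Context: All sets are c.e. subsets of $\omega$. $X\subseteq^*Y$ means $X-Y$ is finite. A collection $\mathcal{G}$ of c.e. sets generates $\mathcal{D}(A)$ if every member of $\mathcal{G}$ is disjoint from $A$ and every c.e. set disjoint from $A$ is $\subseteq^*$ the union of finitely many members of $\mathcal{G}$. -}

module Defs where

open import Data.Nat using (ℕ; zero; suc; _<_)
open import Data.Fin using (Fin)
open import Data.Vec using (Vec; []; _∷_; lookup)
open import Data.List using (List)
open import Data.List.Relation.Unary.Any using (Any)
open import Data.Product using (Σ; ∃; _×_)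
open import Data.Sum using (_⊎_)
open import Data.Empty using (⊥)
open import Relation.Nullary using (¬_)
open import Relation.Binary.PropositionalEquality using (_≡_)

data Code : ℕ → Set where
  zeroᶜ : ∀ {n} → Code n
  succᶜ : Code 1
  projᶜ : ∀ {n} → Fin n → Code n
  compᶜ : ∀ {m n} → Code m → Vec (Code n) m → Code n
  precᶜ : ∀ {n} → Code n → Code (suc (suc n)) → Code (suc n)
  muᶜ   : ∀ {n} → Code (suc n) → Code n

mutual
  data _[_]↓_ : ∀ {n} → Code n → Vec ℕ n → ℕ → Set where
    zero↓ : ∀ {n} {xs : Vec ℕ n} → zeroᶜ [ xs ]↓ 0
    succ↓ : ∀ {x} → succᶜ [ x ∷ [] ]↓ suc x
    proj↓ : ∀ {n} {i : Fin n} {xs} → projᶜ i [ xs ]↓ lookup xs i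
    comp↓ : ∀ {m n} {f : Code m} {gs : Vec (Code n) m} {xs ys y} →
            gs [ xs ]↓* ys → f [ ys ]↓ y → compᶜ f gs [ xs ]↓ y
    prec0↓ : ∀ {n} {f : Code n} {g xs y} →
             f [ xs ]↓ y → precᶜ f g [ 0 ∷ xs ]↓ y
    precS↓ : ∀ {n} {f : Code n} {g xs k r y} →
             precᶜ f g [ k ∷ xs ]↓ r → g [ k ∷ r ∷ xs ]↓ y →
             precᶜ f g [ suc k ∷ xs ]↓ y
    mu↓   : ∀ {n} {f : Code (suc n)} {xs k} →
            f [ k ∷ xs ]↓ 0 →
            (∀ j → j < k → Σ ℕ λ v → f [ j ∷ xs ]↓ suc v) →
            muᶜ f [ xs ]↓ k

  data _[_]↓*_ : ∀ {m n} → Vec (Code n) m → Vec ℕ n → Vec ℕ m → Set where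
    []↓  : ∀ {n} {xs : Vec ℕ n} → [] [ xs ]↓* []
    _∷↓_ : ∀ {m n} {g : Code n} {gs : Vec (Code n) m} {xs y ys} →
           g [ xs ]↓ y → gs [ xs ]↓* ys → (g ∷ gs) [ xs ]↓* (y ∷ ys)

Pred : Set₁
Pred = ℕ → Set

CE : Pred → Set
CE X = Σ (Code 1) λ e → ∀ x → (X x → ∃ λ y → e [ x ∷ [] ]↓ y)
                            × ((∃ λ y → e [ x ∷ [] ]↓ y) → X x)

Computable : Pred → Set
Computable X = Σ (Code 1) λ e → ∀ x →
  (X x × e [ x ∷ [] ]↓ 1) ⊎ (¬ X x × e [ x ∷ [] ]↓ 0)

Disjoint : Pred → Pred → Set
Disjoint X Y = ∀ x → X x → Y x → ⊥

-- X ⊆* Y : X - Y is finite (i.e. bounded).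
_⊆*_ : Pred → Pred → Set
X ⊆* Y = Σ ℕ λ N → ∀ x → X x → ¬ Y x → x < N

⋃[_]_ : List ℕ → (ℕ → Pred) → Pred
(⋃[ is ] G) x = Any (λ i → G i x) is

Generates : (ℕ → Pred) → Pred → Set₁
Generates G A =
  (∀ i → Disjoint (G i) A) ×
  (∀ (W : Pred) → CE W → Disjoint W A → Σ (List ℕ) λ is → W ⊆* (⋃[ is ] G))

PairwiseDisjoint : (ℕ → Pred) → Set
PairwiseDisjoint G = ∀ i j → ¬ i ≡ j → Disjoint (G i) (G j)

module Submission where

-- Since Dᵢ is c.e. and disjoint from A, Dᵢ ⊆* R_J for a finite union
-- R_J = ⋃_{j∈J} R_j; since each R_j is, R_J ⊆* D_L for a finite union D_L.
-- Above a common bound N: if x ∉ R_J then x ∉ Dᵢ; if x ∈ R_J then x lies in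
-- some D_l (l ∈ L), so enumerating the D_l until x appears in one of them,
-- x ∈ Dᵢ iff it has appeared in Dᵢ by then (the D_l are pairwise disjoint).
-- R_J is computable, so this is an algorithm; the finitely many x < N are
-- decided by a finite table.  Excluded middle provides this table and turns
-- the almost inclusions into inclusions above N.

open import Defs
open import Level using (0ℓ)
open import Axiom.ExcludedMiddle using (ExcludedMiddle)
open import Function using (_∘_)
open import Data.Nat using (ℕ; zero; suc; pred; _+_; _<_; _≤_; _⊔_; z≤n; s≤s; _≟_)
open import Data.Nat.Properties
  using (≤-refl; ≤-trans; <⇒≤; <-≤-trans; <⇒≱; m≤m⊔n; m≤n⊔m; m≤n⇒m≤1+n;
         m≤n⇒m<n∨m≡n; ≤-pred; n≤1+n; 1+n≢0)
open import Data.Fin using (Fin; zero; suc; _↑ʳ_)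
open import Data.Vec using (Vec; []; _∷_; lookup; map; _++_)
open import Data.Vec.Properties using (lookup-++ʳ; ∷-injectiveˡ; ∷-injectiveʳ)
open import Data.List using (List; []; _∷_)
import Data.List as List
open import Data.List.Relation.Unary.Any as Any using (Any; here; there)
open import Data.List.Relation.Unary.Any.Properties using (++⁺ˡ; ++⁺ʳ)
open import Data.List.Relation.Unary.All as All using (All; []; _∷_; lookupAny)
open import Data.List.Relation.Unary.All.Properties using (All¬⇒¬Any)
open import Data.Product using (∃; _×_; _,_; proj₁; proj₂)
open import Data.Sum using (_⊎_; inj₁; inj₂; [_,_])
open import Data.Empty using (⊥-elim)
open import Relation.Nullary using (¬_; Dec; yes; no)
open import Relation.Binary.PropositionalEquality
  using (_≡_; _≢_; refl; sym; trans; cong; cong₂; subst)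

-- 1. The clocked evaluator.  Its values: 0 means "no result (yet)", suc y
-- means "result y".

guard : ℕ → ℕ → ℕ
guard zero    b = 0
guard (suc _) b = b

ifz : ℕ → ℕ → ℕ → ℕ
ifz zero    a b = a
ifz (suc _) a b = b

allResults : ∀ {m} → Vec ℕ m → ℕ
allResults []       = 1
allResults (v ∷ vs) = guard v (allResults vs)

-- State of a search for the least zero of f(j, xs) after examining j < k:
-- 0 = still searching, 1 = stuck (some f(j, xs) gave no result),
-- suc (suc y) = found y.  searchStep v k is the state after examining k,
-- given that the search was still going and f(k, xs) evaluated to v.
searchStep : ℕ → ℕ → ℕ
searchStep zero    k = 1
searchStep (suc v) k = ifz v (suc (suc k)) 0

-- ev c s xs evaluates c on xs, letting every unbounded search inspect only
-- the candidates below the budget s (pred turns the search state "found y"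
-- into the result y, and the other two states into "no result").
mutual
  ev : ∀ {n} → Code n → ℕ → Vec ℕ n → ℕ
  ev zeroᶜ        s xs       = 1
  ev succᶜ        s (x ∷ []) = suc (suc x)
  ev (projᶜ i)    s xs       = suc (lookup xs i)
  ev (compᶜ f gs) s xs       = guard (allResults (evAll gs s xs)) (ev f s (map pred (evAll gs s xs)))
  ev (precᶜ f g)  s (k ∷ xs) = evRec f g s xs k
  ev (muᶜ f)      s xs       = pred (evSearch f s xs s)

  evAll : ∀ {m n} → Vec (Code n) m → ℕ → Vec ℕ n → Vec ℕ m
  evAll []       s xs = []
  evAll (g ∷ gs) s xs = ev g s xs ∷ evAll gs s xs

  evRec : ∀ {n} → Code n → Code (suc (suc n)) → ℕ → Vec ℕ n → ℕ → ℕ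
  evRec f g s xs zero    = ev f s xs
  evRec f g s xs (suc k) = guard (evRec f g s xs k) (ev g s (k ∷ pred (evRec f g s xs k) ∷ xs))

  evSearch : ∀ {n} → Code (suc n) → ℕ → Vec ℕ n → ℕ → ℕ
  evSearch f s xs zero    = 0
  evSearch f s xs (suc k) = ifz (evSearch f s xs k) (searchStep (ev f s (k ∷ xs)) k) (evSearch f s xs k)

constC : ∀ {n} → ℕ → Code n
constC zero    = zeroᶜ
constC (suc k) = compᶜ succᶜ (constC k ∷ [])

constC↓ : ∀ {n} k {xs : Vec ℕ n} → constC k [ xs ]↓ k
constC↓ zero    = zero↓
constC↓ (suc k) = comp↓ (constC↓ k ∷↓ []↓) succ↓

predC : Code 1
predC = precᶜ zeroᶜ (projᶜ zero)

predC↓ : ∀ x → predC [ x ∷ [] ]↓ pred x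
predC↓ zero    = prec0↓ zero↓
predC↓ (suc x) = precS↓ (predC↓ x) proj↓

guardC : Code 2
guardC = precᶜ zeroᶜ (projᶜ (suc (suc zero)))

guardC↓ : ∀ a b → guardC [ a ∷ b ∷ [] ]↓ guard a b
guardC↓ zero    b = prec0↓ zero↓
guardC↓ (suc a) b = precS↓ (guardC↓ a b) proj↓

ifzC : Code 3
ifzC = precᶜ (projᶜ zero) (projᶜ (suc (suc (suc zero))))

ifzC↓ : ∀ r a b → ifzC [ r ∷ a ∷ b ∷ [] ]↓ ifz r a b
ifzC↓ zero    a b = prec0↓ proj↓
ifzC↓ (suc r) a b = precS↓ (ifzC↓ r a b) proj↓

plus2C : ∀ {n} → Code n → Code n
plus2C c = compᶜ succᶜ (compᶜ succᶜ (c ∷ []) ∷ [])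

plus2C↓ : ∀ {n} {c : Code n} {xs v} → c [ xs ]↓ v → plus2C c [ xs ]↓ suc (suc v)
plus2C↓ d = comp↓ (comp↓ (d ∷↓ []↓) succ↓ ∷↓ []↓) succ↓

searchStepC : Code 2
searchStepC = precᶜ (constC 1) (compᶜ ifzC (projᶜ zero ∷ plus2C (projᶜ (suc (suc zero))) ∷ zeroᶜ ∷ []))

searchStepC↓ : ∀ v k → searchStepC [ v ∷ k ∷ [] ]↓ searchStep v k
searchStepC↓ zero    k = prec0↓ (constC↓ 1)
searchStepC↓ (suc v) k = precS↓ (searchStepC↓ v k)
  (comp↓ (proj↓ ∷↓ (plus2C↓ proj↓ ∷↓ (zero↓ ∷↓ []↓))) (ifzC↓ v _ _))

allResultsC : ∀ {m n} → Vec (Code n) m → Code n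
allResultsC []       = constC 1
allResultsC (c ∷ cs) = compᶜ guardC (c ∷ allResultsC cs ∷ [])

allResultsC↓ : ∀ {m n} {cs : Vec (Code n) m} {xs vs} →
  cs [ xs ]↓* vs → allResultsC cs [ xs ]↓ allResults vs
allResultsC↓ []↓       = constC↓ 1
allResultsC↓ (d ∷↓ ds) = comp↓ (d ∷↓ (allResultsC↓ ds ∷↓ []↓)) (guardC↓ _ _)

predsC : ∀ {m n} → Vec (Code n) m → Vec (Code n) m
predsC []       = []
predsC (c ∷ cs) = compᶜ predC (c ∷ []) ∷ predsC cs

predsC↓ : ∀ {m n} {cs : Vec (Code n) m} {xs vs} →
  cs [ xs ]↓* vs → predsC cs [ xs ]↓* map pred vs
predsC↓ []↓       = []↓
predsC↓ (d ∷↓ ds) = comp↓ (d ∷↓ []↓) (predC↓ _) ∷↓ predsC↓ ds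

projections : ∀ {m n} → (Fin n → Fin m) → Vec (Code m) n
projections {n = zero}  ρ = []
projections {n = suc n} ρ = projᶜ (ρ zero) ∷ projections (ρ ∘ suc)

projections↓ : ∀ {m n} (ρ : Fin n → Fin m) {xs : Vec ℕ m} (ys : Vec ℕ n) →
  (∀ i → lookup xs (ρ i) ≡ lookup ys i) → projections ρ [ xs ]↓* ys
projections↓ ρ []       eq = []↓
projections↓ ρ (y ∷ ys) eq =
  subst (projᶜ (ρ zero) [ _ ]↓_) (eq zero) proj↓ ∷↓ projections↓ (ρ ∘ suc) ys (eq ∘ suc)

trailing : ∀ {n} k → Vec (Code (k + n)) n
trailing k = projections (k ↑ʳ_)

trailing↓ : ∀ {k n} (ws : Vec ℕ k) (xs : Vec ℕ n) → trailing k [ ws ++ xs ]↓* xs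
trailing↓ ws xs = projections↓ (_ ↑ʳ_) xs (lookup-++ʳ ws xs)

mutual
  evC : ∀ {n} → Code n → Code (suc n)
  evC zeroᶜ        = constC 1
  evC succᶜ        = plus2C (projᶜ (suc zero))
  evC (projᶜ i)    = compᶜ succᶜ (projᶜ (suc i) ∷ [])
  evC (compᶜ f gs) = compᶜ guardC
    (allResultsC (evAllC gs) ∷ compᶜ (evC f) (projᶜ zero ∷ predsC (evAllC gs)) ∷ [])
  evC (precᶜ f g)  = compᶜ (precᶜ (evC f) (evRecStepC g))
    (projᶜ (suc zero) ∷ projᶜ zero ∷ trailing 2)
  evC (muᶜ f)      = compᶜ predC
    (compᶜ (precᶜ zeroᶜ (evSearchStepC f)) (projᶜ zero ∷ projᶜ zero ∷ trailing 1) ∷ [])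

  evAllC : ∀ {m n} → Vec (Code n) m → Vec (Code (suc n)) m
  evAllC []       = []
  evAllC (g ∷ gs) = evC g ∷ evAllC gs

  -- On (k ∷ r ∷ s ∷ xs), with r = evRec f g s xs k: the next value of evRec.
  evRecStepC : ∀ {n} → Code (suc (suc n)) → Code (suc (suc (suc n)))
  evRecStepC g = compᶜ guardC (projᶜ (suc zero) ∷
    compᶜ (evC g) (projᶜ (suc (suc zero)) ∷ projᶜ zero ∷ compᶜ predC (projᶜ (suc zero) ∷ []) ∷ trailing 3)
    ∷ [])

  -- On (k ∷ r ∷ s ∷ xs), with r = evSearch f s xs k: the next search state.
  evSearchStepC : ∀ {n} → Code (suc n) → Code (suc (suc (suc n)))
  evSearchStepC f = compᶜ ifzC (projᶜ (suc zero) ∷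
    compᶜ searchStepC (compᶜ (evC f) (projᶜ (suc (suc zero)) ∷ projᶜ zero ∷ trailing 3) ∷ projᶜ zero ∷ [])
    ∷ projᶜ (suc zero) ∷ [])

mutual
  evC↓ : ∀ {n} (c : Code n) s xs → evC c [ s ∷ xs ]↓ ev c s xs
  evC↓ zeroᶜ        s xs       = constC↓ 1
  evC↓ succᶜ        s (x ∷ []) = plus2C↓ proj↓
  evC↓ (projᶜ i)    s xs       = comp↓ (proj↓ ∷↓ []↓) succ↓
  evC↓ (compᶜ f gs) s xs       =
    comp↓ (allResultsC↓ (evAllC↓ gs s xs) ∷↓
           (comp↓ (proj↓ ∷↓ predsC↓ (evAllC↓ gs s xs)) (evC↓ f s _) ∷↓ []↓))
          (guardC↓ _ _)
  evC↓ (precᶜ f g)  s (k ∷ xs) =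
    comp↓ (proj↓ ∷↓ (proj↓ ∷↓ trailing↓ (s ∷ k ∷ []) xs)) (evRecC↓ f g s xs k)
  evC↓ (muᶜ f)      s xs       =
    comp↓ (comp↓ (proj↓ ∷↓ (proj↓ ∷↓ trailing↓ (s ∷ []) xs)) (evSearchC↓ f s xs s) ∷↓ []↓)
          (predC↓ _)

  evAllC↓ : ∀ {m n} (gs : Vec (Code n) m) s xs → evAllC gs [ s ∷ xs ]↓* evAll gs s xs
  evAllC↓ []       s xs = []↓
  evAllC↓ (g ∷ gs) s xs = evC↓ g s xs ∷↓ evAllC↓ gs s xs

  evRecC↓ : ∀ {n} (f : Code n) g s xs k →
    precᶜ (evC f) (evRecStepC g) [ k ∷ s ∷ xs ]↓ evRec f g s xs k
  evRecC↓ f g s xs zero    = prec0↓ (evC↓ f s xs)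
  evRecC↓ f g s xs (suc k) = precS↓ (evRecC↓ f g s xs k)
    (comp↓ (proj↓ ∷↓
             (comp↓ (proj↓ ∷↓ (proj↓ ∷↓ (comp↓ (proj↓ ∷↓ []↓) (predC↓ _) ∷↓
                                         trailing↓ (k ∷ evRec f g s xs k ∷ s ∷ []) xs)))
                    (evC↓ g s _) ∷↓ []↓))
           (guardC↓ _ _))

  evSearchC↓ : ∀ {n} (f : Code (suc n)) s xs k →
    precᶜ zeroᶜ (evSearchStepC f) [ k ∷ s ∷ xs ]↓ evSearch f s xs k
  evSearchC↓ f s xs zero    = prec0↓ zero↓
  evSearchC↓ f s xs (suc k) = precS↓ (evSearchC↓ f s xs k)
    (comp↓ (proj↓ ∷↓
             (comp↓ (comp↓ (proj↓ ∷↓ (proj↓ ∷↓ trailing↓ (k ∷ evSearch f s xs k ∷ s ∷ []) xs))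
                           (evC↓ f s (k ∷ xs)) ∷↓ (proj↓ ∷↓ []↓))
                    (searchStepC↓ _ _) ∷↓
             (proj↓ ∷↓ []↓)))
           (ifzC↓ _ _ _))

guard-result : ∀ a b {y} → guard a b ≡ suc y → ∃ (λ a′ → a ≡ suc a′) × b ≡ suc y
guard-result (suc a) b eq = (a , refl) , eq

allResults-result : ∀ {m} (vs : Vec ℕ m) {y} → allResults vs ≡ suc y →
                    ∃ λ ys → vs ≡ map suc ys
allResults-result []       eq = [] , refl
allResults-result (v ∷ vs) eq with guard-result v (allResults vs) eq
... | (v′ , refl) , eq′ with allResults-result vs eq′
... | ys , refl = v′ ∷ ys , refl

allResults-map-suc : ∀ {m} (ys : Vec ℕ m) → allResults (map suc ys) ≡ 1
allResults-map-suc []       = refl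
allResults-map-suc (y ∷ ys) = allResults-map-suc ys

pred-map-suc : ∀ {m} (ys : Vec ℕ m) → map pred (map suc ys) ≡ ys
pred-map-suc []       = refl
pred-map-suc (y ∷ ys) = cong (y ∷_) (pred-map-suc ys)

pred-result : ∀ a {y} → pred a ≡ suc y → a ≡ suc (suc y)
pred-result (suc a) refl = refl

module Search {n} (f : Code (suc n)) (s : ℕ) (xs : Vec ℕ n) where

  F : ℕ → ℕ
  F j = ev f s (j ∷ xs)

  PassedOver : ℕ → Set
  PassedOver j = ∃ λ v → F j ≡ suc (suc v)

  searching : ∀ k → evSearch f s xs k ≡ 0 → ∀ j → j < k → PassedOver j
  searching (suc k) eq j j<k with evSearch f s xs k in eqₖ | F k in eqF
  searching (suc k) ()  j j<k           | zero  | zero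
  searching (suc k) ()  j j<k           | zero  | suc zero
  searching (suc k) eq  j (s≤s j≤k)     | zero  | suc (suc v) with m≤n⇒m<n∨m≡n j≤k
  ... | inj₁ j<k  = searching k eqₖ j j<k
  ... | inj₂ refl = v , eqF
  searching (suc k) ()  j j<k           | suc r | _

  found : ∀ k {y} → evSearch f s xs k ≡ suc (suc y) →
          y < k × F y ≡ 1 × (∀ j → j < y → PassedOver j)
  found (suc k) eq with evSearch f s xs k in eqₖ | F k in eqF
  found (suc k) ()   | zero              | zero
  found (suc k) refl | zero              | suc zero    = ≤-refl , eqF , searching k eqₖ
  found (suc k) ()   | zero              | suc (suc v)
  found (suc k) ()   | suc zero          | _
  found (suc k) refl | suc (suc r)       | _ with found k eqₖ
  ... | y<k , Fy , before = m≤n⇒m≤1+n y<k , Fy , before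

  searching-upto : ∀ y → (∀ j → j < y → PassedOver j) → ∀ k → k ≤ y → evSearch f s xs k ≡ 0
  searching-upto y before zero    k≤y = refl
  searching-upto y before (suc k) k<y
    rewrite searching-upto y before k (<⇒≤ k<y) | proj₂ (before k k<y) = refl

  found-after : ∀ y → (∀ j → j < y → PassedOver j) → F y ≡ 1 →
                ∀ k → y < k → evSearch f s xs k ≡ suc (suc y)
  found-after y before Fy (suc k) (s≤s y≤k) with m≤n⇒m<n∨m≡n y≤k
  ... | inj₁ y<k  rewrite found-after y before Fy k y<k = refl
  ... | inj₂ refl rewrite searching-upto y before y ≤-refl | Fy = refl

mutual
  ev-sound : ∀ {n} (c : Code n) s xs {y} → ev c s xs ≡ suc y → c [ xs ]↓ y
  ev-sound zeroᶜ        s xs       refl = zero↓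
  ev-sound succᶜ        s (x ∷ []) refl = succ↓
  ev-sound (projᶜ i)    s xs       refl = proj↓
  ev-sound (compᶜ f gs) s xs       eq with guard-result _ _ eq
  ... | (_ , args) , eqf with allResults-result (evAll gs s xs) args
  ... | ys , eqs rewrite eqs | pred-map-suc ys =
    comp↓ (evAll-sound gs s xs ys eqs) (ev-sound f s ys eqf)
  ev-sound (precᶜ f g)  s (k ∷ xs) eq = evRec-sound f g s xs k eq
  ev-sound (muᶜ f)      s xs       eq with Search.found f s xs s (pred-result _ eq)
  ... | _ , Fy , before =
    mu↓ (ev-sound f s _ Fy) (λ j j<y → let (v , Fj) = before j j<y in v , ev-sound f s _ Fj)

  evAll-sound : ∀ {m n} (gs : Vec (Code n) m) s xs ys → evAll gs s xs ≡ map suc ys → gs [ xs ]↓* ys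
  evAll-sound []       s xs []       eq = []↓
  evAll-sound (g ∷ gs) s xs (y ∷ ys) eq =
    ev-sound g s xs (∷-injectiveˡ eq) ∷↓ evAll-sound gs s xs ys (∷-injectiveʳ eq)

  evRec-sound : ∀ {n} (f : Code n) g s xs k {y} →
                evRec f g s xs k ≡ suc y → precᶜ f g [ k ∷ xs ]↓ y
  evRec-sound f g s xs zero    eq = prec0↓ (ev-sound f s xs eq)
  evRec-sound f g s xs (suc k) eq with guard-result (evRec f g s xs k) _ eq
  ... | (r , eqr) , eqg rewrite eqr = precS↓ (evRec-sound f g s xs k eqr) (ev-sound g s _ eqg)

ev-comp : ∀ {m n} (f : Code m) (gs : Vec (Code n) m) s xs ys {y} →
          evAll gs s xs ≡ map suc ys → ev f s ys ≡ suc y → ev (compᶜ f gs) s xs ≡ suc y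
ev-comp f gs s xs ys eqs eqf rewrite eqs | allResults-map-suc ys | pred-map-suc ys = eqf

evRec-step : ∀ {n} (f : Code n) g s xs k {r y} →
             evRec f g s xs k ≡ suc r → ev g s (k ∷ r ∷ xs) ≡ suc y →
             evRec f g s xs (suc k) ≡ suc y
evRec-step f g s xs k eqr eqg rewrite eqr = eqg

mutual
  ev-mono : ∀ {n} (c : Code n) {s s′} xs {y} → s ≤ s′ → ev c s xs ≡ suc y → ev c s′ xs ≡ suc y
  ev-mono zeroᶜ        xs       le eq = eq
  ev-mono succᶜ        (x ∷ []) le eq = eq
  ev-mono (projᶜ i)    xs       le eq = eq
  ev-mono (compᶜ f gs) {s} xs   le eq with guard-result _ _ eq
  ... | (_ , args) , eqf with allResults-result (evAll gs s xs) args
  ... | ys , eqs rewrite eqs | pred-map-suc ys =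
    ev-comp f gs _ xs ys (evAll-mono gs xs ys le eqs) (ev-mono f ys le eqf)
  ev-mono (precᶜ f g)  (k ∷ xs) le eq = evRec-mono f g xs k le eq
  ev-mono (muᶜ f) {s} {s′} xs   le eq with Search.found f s xs s (pred-result _ eq)
  ... | y<s , Fy , before
    rewrite Search.found-after f s′ xs _
              (λ j j<y → let (v , Fj) = before j j<y in v , ev-mono f _ le Fj)
              (ev-mono f _ le Fy) s′ (<-≤-trans y<s le) = refl

  evAll-mono : ∀ {m n} (gs : Vec (Code n) m) {s s′} xs ys → s ≤ s′ →
               evAll gs s xs ≡ map suc ys → evAll gs s′ xs ≡ map suc ys
  evAll-mono []       xs []       le eq = refl
  evAll-mono (g ∷ gs) xs (y ∷ ys) le eq =
    cong₂ _∷_ (ev-mono g xs le (∷-injectiveˡ eq)) (evAll-mono gs xs ys le (∷-injectiveʳ eq))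

  evRec-mono : ∀ {n} (f : Code n) g {s s′} xs k {y} → s ≤ s′ →
               evRec f g s xs k ≡ suc y → evRec f g s′ xs k ≡ suc y
  evRec-mono f g xs zero    le eq = ev-mono f xs le eq
  evRec-mono f g {s} xs (suc k) le eq with guard-result (evRec f g s xs k) _ eq
  ... | (r , eqr) , eqg rewrite eqr | evRec-mono f g xs k le eqr = ev-mono g _ le eqg

common-stage : ∀ k (P : ℕ → ℕ → Set) → (∀ j {s s′} → s ≤ s′ → P j s → P j s′) →
               (∀ j → j < k → ∃ (P j)) → ∃ λ S → ∀ j → j < k → P j S
common-stage zero    P mono stages = 0 , λ j ()
common-stage (suc k) P mono stages
  with common-stage k P mono (λ j j<k → stages j (<-≤-trans j<k (n≤1+n k))) | stages k ≤-refl
... | S , below | s , atk = S ⊔ s , λ j j≤k → upto j (m≤n⇒m<n∨m≡n (≤-pred j≤k))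
  where
  upto : ∀ j → j < k ⊎ j ≡ k → P j (S ⊔ s)
  upto j (inj₁ j<k)  = mono j (m≤m⊔n S s) (below j j<k)
  upto j (inj₂ refl) = mono j (m≤n⊔m S s) atk

mutual
  ev-complete : ∀ {n} {c : Code n} {xs y} → c [ xs ]↓ y → ∃ λ s → ev c s xs ≡ suc y
  ev-complete zero↓ = 0 , refl
  ev-complete succ↓ = 0 , refl
  ev-complete proj↓ = 0 , refl
  ev-complete (comp↓ {f = f} {gs} {xs} {ys} ds d) with evAll-complete ds | ev-complete d
  ... | s₁ , eqs | s₂ , eqf =
    s₁ ⊔ s₂ , ev-comp f gs _ xs ys (evAll-mono gs xs ys (m≤m⊔n s₁ s₂) eqs)
                                   (ev-mono f ys (m≤n⊔m s₁ s₂) eqf)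
  ev-complete (prec0↓ d) = ev-complete d
  ev-complete (precS↓ {f = f} {g} {xs} {k} d₁ d₂) with ev-complete d₁ | ev-complete d₂
  ... | s₁ , eqr | s₂ , eqg =
    s₁ ⊔ s₂ , evRec-step f g _ xs k (evRec-mono f g xs k (m≤m⊔n s₁ s₂) eqr)
                                    (ev-mono g _ (m≤n⊔m s₁ s₂) eqg)
  ev-complete (mu↓ {f = f} {xs} {k} dk ds)
    with ev-complete dk
       | common-stage k (λ j s → ∃ λ v → ev f s (j ∷ xs) ≡ suc (suc v))
           (λ j le (v , eq) → v , ev-mono f _ le eq)
           (λ j j<k → let (v , d) = ds j j<k ; (s , eq) = ev-complete d in s , v , eq)
  ... | s₀ , Fk | S , before =
    T , cong pred (Search.found-after f T xs k
                    (λ j j<k → let (v , eq) = before j j<k in v , ev-mono f _ S≤T eq)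
                    (ev-mono f _ s₀≤T Fk) T k<T)
    where
    T = suc k ⊔ (s₀ ⊔ S)
    s₀≤T : s₀ ≤ T
    s₀≤T = ≤-trans (m≤m⊔n s₀ S) (m≤n⊔m (suc k) (s₀ ⊔ S))
    S≤T : S ≤ T
    S≤T = ≤-trans (m≤n⊔m s₀ S) (m≤n⊔m (suc k) (s₀ ⊔ S))
    k<T : k < T
    k<T = m≤m⊔n (suc k) (s₀ ⊔ S)

  evAll-complete : ∀ {m n} {gs : Vec (Code n) m} {xs ys} → gs [ xs ]↓* ys →
                   ∃ λ s → evAll gs s xs ≡ map suc ys
  evAll-complete []↓ = 0 , refl
  evAll-complete (_∷↓_ {g = g} {gs} {xs} {ys = ys} d ds) with ev-complete d | evAll-complete ds
  ... | s₁ , eq | s₂ , eqs =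
    s₁ ⊔ s₂ , cong₂ _∷_ (ev-mono g xs (m≤m⊔n s₁ s₂) eq)
                        (evAll-mono gs xs ys (m≤n⊔m s₁ s₂) eqs)

-- 2. Total recursive functions: a total function together with a code
-- computing it.
record Recursive (n : ℕ) : Set where
  constructor recursive
  field
    code     : Code n
    fun      : Vec ℕ n → ℕ
    computes : ∀ xs → code [ xs ]↓ fun xs
open Recursive

codeAll : ∀ {m n} → Vec (Recursive n) m → Vec (Code n) m
codeAll []       = []
codeAll (t ∷ ts) = code t ∷ codeAll ts

funAll : ∀ {m n} → Vec (Recursive n) m → Vec ℕ n → Vec ℕ m
funAll []       xs = []
funAll (t ∷ ts) xs = fun t xs ∷ funAll ts xs

computesAll : ∀ {m n} (ts : Vec (Recursive n) m) xs → codeAll ts [ xs ]↓* funAll ts xs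
computesAll []       xs = []↓
computesAll (t ∷ ts) xs = computes t xs ∷↓ computesAll ts xs

composeR : ∀ {m n} → Recursive m → Vec (Recursive n) m → Recursive n
composeR f ts = recursive (compᶜ (code f) (codeAll ts)) (fun f ∘ funAll ts)
  (λ xs → comp↓ (computesAll ts xs) (computes f _))

projR : ∀ {n} → Fin n → Recursive n
projR i = recursive (projᶜ i) (λ xs → lookup xs i) (λ xs → proj↓)

constR : ∀ {n} → ℕ → Recursive n
constR k = recursive (constC k) (λ _ → k) (λ xs → constC↓ k)

predR : Recursive 1
predR = recursive predC (λ { (x ∷ []) → pred x }) (λ { (x ∷ []) → predC↓ x })

ifR : ∀ {n} → Recursive n → Recursive n → Recursive n → Recursive n
ifR r a b = composeR (recursive ifzC (λ { (r ∷ a ∷ b ∷ []) → ifz r a b })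
                                     (λ { (r ∷ a ∷ b ∷ []) → ifzC↓ r a b }))
                     (r ∷ a ∷ b ∷ [])

evR : ∀ {n} → Code n → Recursive (suc n)
evR c = recursive (evC c) (λ { (s ∷ xs) → ev c s xs }) (λ { (s ∷ xs) → evC↓ c s xs })

tableR : ℕ → (ℕ → ℕ) → Recursive 1
tableR zero    b = constR 0
tableR (suc N) b = ifR (projR zero) (constR (suc (b 0)))
                       (composeR (tableR N (b ∘ suc)) (predR ∷ []))

tableR-cases : ∀ N b x → (x < N × fun (tableR N b) (x ∷ []) ≡ suc (b x))
                       ⊎ (N ≤ x × fun (tableR N b) (x ∷ []) ≡ 0)
tableR-cases zero    b x       = inj₂ (z≤n , refl)
tableR-cases (suc N) b zero    = inj₁ (s≤s z≤n , refl)
tableR-cases (suc N) b (suc x) with tableR-cases N (b ∘ suc) x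
... | inj₁ (x<N , eq) = inj₁ (s≤s x<N , eq)
... | inj₂ (N≤x , eq) = inj₂ (s≤s N≤x , eq)

Positive : ℕ → Set
Positive v = ∃ λ y → v ≡ suc y

anyR : ∀ {n} → (ℕ → Recursive n) → List ℕ → Recursive n
anyR t []      = constR 0
anyR t (l ∷ L) = ifR (t l) (anyR t L) (constR 1)

anyR-cases : ∀ {n} (t : ℕ → Recursive n) L xs →
  (fun (anyR t L) xs ≡ 1 × Any (λ l → Positive (fun (t l) xs)) L) ⊎
  (fun (anyR t L) xs ≡ 0 × All (λ l → fun (t l) xs ≡ 0) L)
anyR-cases t []      xs = inj₂ (refl , [])
anyR-cases t (l ∷ L) xs with fun (t l) xs in eq
... | suc y = inj₁ (refl , here (y , eq))
... | zero with anyR-cases t L xs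
...   | inj₁ (eq₁ , some) = inj₁ (eq₁ , there some)
...   | inj₂ (eq₀ , none) = inj₂ (eq₀ , eq ∷ none)

anyR-positive : ∀ {n} (t : ℕ → Recursive n) L xs →
  Any (λ l → Positive (fun (t l) xs)) L → fun (anyR t L) xs ≡ 1
anyR-positive t L xs some with anyR-cases t L xs
... | inj₁ (eq , _)   = eq
... | inj₂ (_ , none) = let (vanished , _ , positive) = lookupAny none some in
                        ⊥-elim (1+n≢0 (trans (sym positive) vanished))

-- 3. Deciding sets.  The value v decides membership of x in X: 1 for
-- members, 0 otherwise.
data Decides (X : Pred) (x : ℕ) : ℕ → Set where
  member    : X x → Decides X x 1
  nonmember : ¬ X x → Decides X x 0

decides-positive : ∀ {X x v} → Decides X x v → Positive v → X x
decides-positive (member p)    _       = p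
decides-positive (nonmember _) (_ , ())

decides-zero : ∀ {X x v} → Decides X x v → v ≡ 0 → ¬ X x
decides-zero (member _)     ()
decides-zero (nonmember np) _ = np

decision : ∀ {X x v} {c : Code 1} → Decides X x v → c [ x ∷ [] ]↓ v →
           (X x × c [ x ∷ [] ]↓ 1) ⊎ (¬ X x × c [ x ∷ [] ]↓ 0)
decision (member p)     d = inj₁ (p , d)
decision (nonmember np) d = inj₂ (np , d)

computable-from : ∀ {X} (t : Recursive 1) → (∀ x → Decides X x (fun t (x ∷ []))) → Computable X
computable-from t decides = code t , λ x → decision (decides x) (computes t (x ∷ []))

decider : ∀ {X} → Computable X → Recursive 1
decider (e , h) = recursive e (λ { (x ∷ []) → value (h x) }) (λ { (x ∷ []) → value-computed (h x) })
  where
  value : ∀ {x P} → (P × e [ x ∷ [] ]↓ 1) ⊎ (¬ P × e [ x ∷ [] ]↓ 0) → ℕ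
  value (inj₁ _) = 1
  value (inj₂ _) = 0

  value-computed : ∀ {x P} (p : (P × e [ x ∷ [] ]↓ 1) ⊎ (¬ P × e [ x ∷ [] ]↓ 0)) →
                   e [ x ∷ [] ]↓ value p
  value-computed (inj₁ (_ , d)) = d
  value-computed (inj₂ (_ , d)) = d

decider-decides : ∀ {X} (c : Computable X) x → Decides X x (fun (decider c) (x ∷ []))
decider-decides (e , h) x with h x
... | inj₁ (p , _)  = member p
... | inj₂ (np , _) = nonmember np

⋃-computable : ∀ {R : ℕ → Pred} → (∀ j → Computable (R j)) → ∀ J → Computable (⋃[ J ] R)
⋃-computable {R} compR J = computable-from (anyR (decider ∘ compR) J) decides
  where
  decides : ∀ x → Decides (⋃[ J ] R) x (fun (anyR (decider ∘ compR) J) (x ∷ []))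
  decides x with anyR-cases (decider ∘ compR) J (x ∷ [])
  ... | inj₁ (eq , some) rewrite eq =
    member (Any.map (λ {j} → decides-positive (decider-decides (compR j) x)) some)
  ... | inj₂ (eq , none) rewrite eq =
    nonmember (All¬⇒¬Any (All.map (λ {j} → decides-zero (decider-decides (compR j) x)) none))

least-below : (P : ℕ → Set) → (∀ n → Dec (P n)) → ∀ n →
              (∃ λ k → P k × ∀ j → j < k → ¬ P j) ⊎ (∀ j → j < n → ¬ P j)
least-below P P? zero = inj₂ (λ j ())
least-below P P? (suc n) with least-below P P? n | P? n
... | inj₁ found | _      = inj₁ found
... | inj₂ none  | yes pn = inj₁ (n , pn , none)
... | inj₂ none  | no ¬pn =
  inj₂ λ j j≤n → [ none j , (λ { refl → ¬pn }) ] (m≤n⇒m<n∨m≡n (≤-pred j≤n))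

least : (P : ℕ → Set) → (∀ n → Dec (P n)) → ∃ P → ∃ λ k → P k × ∀ j → j < k → ¬ P j
least P P? (n , pn) with least-below P P? (suc n)
... | inj₁ found = found
... | inj₂ none  = ⊥-elim (none n ≤-refl pn)

nonzero-positive : ∀ {v} → v ≢ 0 → Positive v
nonzero-positive {zero}  v≢0 = ⊥-elim (v≢0 refl)
nonzero-positive {suc v} _   = v , refl

minimise : ∀ {n} (t : Recursive (suc n)) xs → ∃ (λ s → fun t (s ∷ xs) ≡ 0) →
           ∃ λ k → muᶜ (code t) [ xs ]↓ k × fun t (k ∷ xs) ≡ 0
minimise t xs has-zero with least (λ s → fun t (s ∷ xs) ≡ 0) (λ s → fun t (s ∷ xs) ≟ 0) has-zero
... | k , zero-at-k , before =
  k , mu↓ (at k zero-at-k) (λ j j<k → let (v , eq) = nonzero-positive (before j j<k) in v , at j eq)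
    , zero-at-k
  where
  at : ∀ j {v} → fun t (j ∷ xs) ≡ v → code t [ j ∷ xs ]↓ v
  at j eq = subst (code t [ j ∷ xs ]↓_) eq (computes t (j ∷ xs))

computable-by-search : (X : Pred) (stop answer : Recursive 2) →
  (∀ x → ∃ λ s → fun stop (s ∷ x ∷ []) ≡ 0) →
  (∀ x s → fun stop (s ∷ x ∷ []) ≡ 0 → Decides X x (fun answer (s ∷ x ∷ []))) →
  Computable X
computable-by-search X stop answer terminates correct = searchC , decide
  where
  searchC : Code 1
  searchC = compᶜ (code answer) (muᶜ (code stop) ∷ projᶜ zero ∷ [])

  decide : ∀ x → (X x × searchC [ x ∷ [] ]↓ 1) ⊎ (¬ X x × searchC [ x ∷ [] ]↓ 0)
  decide x with minimise stop (x ∷ []) (terminates x)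
  ... | s , stage↓ , stopped =
    decision (correct x s stopped)
             (comp↓ (stage↓ ∷↓ (proj↓ ∷↓ []↓)) (computes answer (s ∷ x ∷ [])))

-- The same, when the hypotheses only hold for x ≥ N: the finitely many
-- x < N are decided by a table, which exists by excluded middle.
computable-above-by-search : ExcludedMiddle 0ℓ → (X : Pred) (N : ℕ) (stop answer : Recursive 2) →
  (∀ x → N ≤ x → ∃ λ s → fun stop (s ∷ x ∷ []) ≡ 0) →
  (∀ x s → N ≤ x → fun stop (s ∷ x ∷ []) ≡ 0 → Decides X x (fun answer (s ∷ x ∷ []))) →
  Computable X
computable-above-by-search em X N stop answer terminates correct =
  computable-by-search X stop′ answer′ terminates′ correct′
  where
  indicator : ∀ {P : Set} → Dec P → ℕ
  indicator (yes _) = 1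
  indicator (no _)  = 0

  indicator-decides : ∀ x (d : Dec (X x)) → Decides X x (indicator d)
  indicator-decides x (yes p) = member p
  indicator-decides x (no ¬p) = nonmember ¬p

  table : Recursive 2
  table = composeR (tableR N (λ x → indicator (em {X x}))) (projR (suc zero) ∷ [])

  stop′ answer′ : Recursive 2
  stop′   = ifR table stop (constR 0)
  answer′ = ifR table answer (composeR predR (table ∷ []))

  terminates′ : ∀ x → ∃ λ s → fun stop′ (s ∷ x ∷ []) ≡ 0
  terminates′ x with tableR-cases N (λ x → indicator (em {X x})) x
  ... | inj₁ (_ , eq)   rewrite eq = 0 , refl
  ... | inj₂ (N≤x , eq) rewrite eq = terminates x N≤x

  correct′ : ∀ x s → fun stop′ (s ∷ x ∷ []) ≡ 0 → Decides X x (fun answer′ (s ∷ x ∷ []))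
  correct′ x s stopped with tableR-cases N (λ x → indicator (em {X x})) x
  ... | inj₁ (_ , eq)   rewrite eq = indicator-decides x em
  ... | inj₂ (N≤x , eq) rewrite eq = correct x s N≤x stopped

-- 4. Enumerations of c.e. sets: enumeration w (s, x) is positive iff x has
-- been enumerated into W by stage s.
enumeration : ∀ {W} → CE W → Recursive 2
enumeration (e , _) = evR e

enumerated-sound : ∀ {W} (w : CE W) s x → Positive (fun (enumeration w) (s ∷ x ∷ [])) → W x
enumerated-sound (e , spec) s x (y , eq) = proj₂ (spec x) (y , ev-sound e s (x ∷ []) eq)

enumerated-complete : ∀ {W} (w : CE W) x → W x →
                      ∃ λ s → Positive (fun (enumeration w) (s ∷ x ∷ []))
enumerated-complete (e , spec) x p with proj₁ (spec x) p
... | y , d with ev-complete d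
...   | s , eq = s , y , eq

enumerated-some : ∀ {D : ℕ → Pred} (ceD : ∀ l → CE (D l)) x {L} → Any (λ l → D l x) L →
  ∃ λ s → Any (λ l → Positive (fun (enumeration (ceD l)) (s ∷ x ∷ []))) L
enumerated-some ceD x (here {l} p) with enumerated-complete (ceD l) x p
... | s , pos = s , here pos
enumerated-some ceD x (there some) with enumerated-some ceD x some
... | s , pos = s , there pos

enumerated-elsewhere : ∀ {D : ℕ → Pred} (ceD : ∀ l → CE (D l)) → PairwiseDisjoint D →
  ∀ {i l} s x → Positive (fun (enumeration (ceD l)) (s ∷ x ∷ [])) →
  fun (enumeration (ceD i)) (s ∷ x ∷ []) ≡ 0 → ¬ D i x
enumerated-elsewhere ceD disjoint {i} {l} s x (y , inDₗ) notYetInDᵢ d with l ≟ i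
... | yes refl = 1+n≢0 (trans (sym inDₗ) notYetInDᵢ)
... | no l≢i   = disjoint l i l≢i x (enumerated-sound (ceD l) s x (y , inDₗ)) d

⊆*-above : ExcludedMiddle 0ℓ → ∀ {X Y} (X⊆*Y : X ⊆* Y) {x} → proj₁ X⊆*Y ≤ x → X x → Y x
⊆*-above em {Y = Y} (N , below) {x} N≤x p with em {Y x}
... | yes q  = q
... | no ¬q  = ⊥-elim (<⇒≱ (below x p ¬q) N≤x)

⊆*-⋃ : ∀ {R D : ℕ → Pred} → (∀ j → ∃ λ L → R j ⊆* (⋃[ L ] D)) →
       ∀ J → ∃ λ L → (⋃[ J ] R) ⊆* (⋃[ L ] D)
⊆*-⋃ {R} {D} covers []      = [] , 0 , λ x ()
⊆*-⋃ {R} {D} covers (j ∷ J) with covers j | ⊆*-⋃ covers J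
... | Lⱼ , Nⱼ , belowⱼ | L , N , below = Lⱼ List.++ L , Nⱼ ⊔ N , bound
  where
  bound : ∀ x → (⋃[ j ∷ J ] R) x → ¬ (⋃[ Lⱼ List.++ L ] D) x → x < Nⱼ ⊔ N
  bound x (here p)  ¬q = <-≤-trans (belowⱼ x p (¬q ∘ ++⁺ˡ)) (m≤m⊔n Nⱼ N)
  bound x (there p) ¬q = <-≤-trans (below x p (¬q ∘ ++⁺ʳ Lⱼ)) (m≤n⊔m Nⱼ N)

-- 5. The core of the argument: in a pairwise disjoint family of c.e. sets, a
-- member D i with D i ⊆* R_J ⊆* D_L for a computable finite union R_J and a
-- finite union D_L of the family is computable.
module Sandwiched (em : ExcludedMiddle 0ℓ) {R D : ℕ → Pred}
  (ceD : ∀ l → CE (D l)) (disjoint : PairwiseDisjoint D) (i : ℕ) {J L : List ℕ}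
  (computable-RJ : Computable (⋃[ J ] R))
  (Dᵢ⊆*RJ : D i ⊆* (⋃[ J ] R)) (RJ⊆*DL : (⋃[ J ] R) ⊆* (⋃[ L ] D)) where

  N : ℕ
  N = proj₁ Dᵢ⊆*RJ ⊔ proj₁ RJ⊆*DL

  -- All functions below take arguments (s ∷ x ∷ []).
  enumerationD : ℕ → Recursive 2
  enumerationD l = enumeration (ceD l)

  inRJ enumeratedDL : Recursive 2
  inRJ         = composeR (decider computable-RJ) (projR (suc zero) ∷ [])
  enumeratedDL = anyR enumerationD L

  -- Outside R_J we may stop at once; inside, we wait until x appears in D_L.
  stop answer : Recursive 2
  stop   = ifR inRJ (constR 0) (ifR enumeratedDL (constR 1) (constR 0))
  answer = ifR inRJ (constR 0) (ifR (enumerationD i) (constR 0) (constR 1))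

  RJ-decides : ∀ x → Decides (⋃[ J ] R) x (fun (decider computable-RJ) (x ∷ []))
  RJ-decides = decider-decides computable-RJ

  terminates : ∀ x → N ≤ x → ∃ λ s → fun stop (s ∷ x ∷ []) ≡ 0
  terminates x N≤x with fun (decider computable-RJ) (x ∷ []) | RJ-decides x
  ... | .0 | nonmember _ = 0 , refl
  ... | .1 | member p
    with enumerated-some ceD x (⊆*-above em RJ⊆*DL (≤-trans (m≤n⊔m _ _) N≤x) p)
  ...   | s , some = s , cong (λ v → ifz v 1 0) (anyR-positive enumerationD L (s ∷ x ∷ []) some)

  correct : ∀ x s → N ≤ x → fun stop (s ∷ x ∷ []) ≡ 0 → Decides (D i) x (fun answer (s ∷ x ∷ []))
  correct x s N≤x stopped with fun (decider computable-RJ) (x ∷ []) | RJ-decides x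
  ... | .0 | nonmember ¬p = nonmember (¬p ∘ ⊆*-above em Dᵢ⊆*RJ (≤-trans (m≤m⊔n _ _) N≤x))
  ... | .1 | member p with anyR-cases enumerationD L (s ∷ x ∷ [])
  ...   | inj₂ (eq , _) = ⊥-elim (1+n≢0 (trans (sym (cong (λ v → ifz v 1 0) eq)) stopped))
  ...   | inj₁ (_ , some) with fun (enumerationD i) (s ∷ x ∷ []) in eqᵢ
  ...     | suc y = member (enumerated-sound (ceD i) s x (y , eqᵢ))
  ...     | zero  = nonmember (enumerated-elsewhere ceD disjoint s x (proj₂ (Any.satisfied some)) eqᵢ)

  computable : Computable (D i)
  computable = computable-above-by-search em (D i) N stop answer terminates correct

-- Dᵢ ⊆* R_J because Dᵢ is c.e. and disjoint from A; R_J ⊆* D_L because each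
-- R_j is; R_J is computable as a finite union of computable sets.
lemma3p7 : ExcludedMiddle 0ℓ →
    (A : Pred) → CE A →
    (R D : ℕ → Pred) →
    (∀ i → CE (R i)) → PairwiseDisjoint R → Generates R A →
    (∀ i → CE (D i)) → PairwiseDisjoint D → Generates D A →
    (∀ i → Computable (R i)) →
    ∀ i → Computable (D i)
lemma3p7 em _ _ R D ceR _ (R-disjoint-A , R-generates)
                          ceD disjointD (D-disjoint-A , D-generates) computableR i =
  let J , Dᵢ⊆*RJ = R-generates (D i) (ceD i) (D-disjoint-A i)
      L , RJ⊆*DL = ⊆*-⋃ (λ j → D-generates (R j) (ceR j) (R-disjoint-A j)) J
  in Sandwiched.computable em ceD disjointD i (⋃-computable computableR J) Dᵢ⊆*RJ RJ⊆*DL
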